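{- Let $D$ be a square-free integer other than $1$, $K=\mathbb{Q}(\sqrt D)$ with ring of integers $\mathcal{O}_K$, and let $\delta=2$ if $D\equiv 1\pmod 4$ and $\delta=1$ otherwise. Let $q$ be an odd prime with $q\nmid D$ and $D\equiv n^2\pmod q$, and write $n^2-D=lq$ with $l\in\mathbb{Z}$. Let $a,b,c,d$ be integers (with $a\equiv b\pmod 2$ and $c\equiv d\pmod 2$ when $D\equiv1\pmod4$) and put $\gamma=\dfrac{qa+nc+dD+(qb+c+nd)\sqrt D}{\delta}$. Then $(q,n+\sqrt D)=(\gamma)$ if and only if $$qa^2-qDb^2+2(nc+dD)a-2D(c+nd)b+(c^2-d^2D)l\pm\delta^2=0$$ for one of the two choices of sign; that is, $(q,n+\sqrt D)$ is principal with a generator of this form exactly when $x=a,y=b$ solves the Diophantine equation $qx^2-qDy^2+2(nc+dD)x-2D(c+nd)y+(c^2-d^2D)l\pm\delta^2=0$.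
   Context: $(q,n+\sqrt D)$ is the ideal of $\mathcal{O}_K$ generated by $q$ and $n+\sqrt D$; $(\gamma)$ is the principal ideal generated by $\gamma$. Every element of $(q,n+\sqrt D)$ can be written in the form of $\gamma$ above. -}

module Defs where

open import Data.Nat as ℕ using (ℕ; _≡ᵇ_)
open import Data.Integer using (ℤ; +_; _+_; _-_; _*_; ∣_∣)
open import Data.Integer.DivMod using (_%ℕ_)
open import Data.Integer.Divisibility using (_∣_)
open import Data.Bool using (if_then_else_)
open import Data.Product using (∃; ∃₂; _×_)
open import Relation.Binary.PropositionalEquality using (_≡_)

-- Square-free integer: no square of a natural number > 1 divides it
-- (this also excludes D = 0).
SquareFree : ℤ → Set
SquareFree D = ∀ (m : ℕ) → (+ m * + m) ∣ D → m ≡ 1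

OneMod4 : ℤ → Set
OneMod4 D = D %ℕ 4 ≡ 1

δ : ℤ → ℤ
δ D = if (D %ℕ 4) ≡ᵇ 1 then + 2 else + 1

-- Elements of ℤ[√D]: x + y √D.  An element α of K = ℚ(√D) is represented
-- by its "numerator" δ·α = x + y√D ∈ ℤ[√D]; i.e. α = (x + y√D)/δ.
infix 4 _+√_
record ℤ√ : Set where
  constructor _+√_
  field
    re : ℤ
    im : ℤ
open ℤ√ public

mul : ℤ → ℤ√ → ℤ√ → ℤ√
mul D (x₁ +√ y₁) (x₂ +√ y₂) = (x₁ * x₂ + D * (y₁ * y₂)) +√ (x₁ * y₂ + x₂ * y₁)

add : ℤ√ → ℤ√ → ℤ√
add (x₁ +√ y₁) (x₂ +√ y₂) = (x₁ + x₂) +√ (y₁ + y₂)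

scale : ℤ → ℤ√ → ℤ√
scale k (x +√ y) = (k * x) +√ (k * y)

-- The numerator x + y√D represents an element (x + y√D)/δ of 𝒪_K:
-- 𝒪_K = {(x + y√D)/2 : x ≡ y mod 2} if D ≡ 1 (mod 4), and ℤ[√D] otherwise.
InO : ℤ → ℤ√ → Set
InO D (x +√ y) = OneMod4 D → + 2 ∣ (x - y)

-- α = z/δ lies in the ideal (q, n + √D) of 𝒪_K:
-- α = μ q + λ (n + √D) with μ = M/δ, λ = L/δ in 𝒪_K,
-- i.e. z = q·M + (n + √D)·L.
InIdeal : ℤ → ℤ → ℤ → ℤ√ → Set
InIdeal D q n z = ∃₂ λ M L → InO D M × InO D L ×
  (z ≡ add (scale q M) (mul D (n +√ + 1) L))

-- α = z/δ lies in the principal ideal (γ) with γ = G/δ: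
-- α = μ γ with μ = M/δ ∈ 𝒪_K, i.e. δ·z = M·G.
InPrincipal : ℤ → ℤ√ → ℤ√ → Set
InPrincipal D G z = ∃ λ M → InO D M × (scale (δ D) z ≡ mul D M G)

γnum : ℤ → ℤ → ℤ → ℤ → ℤ → ℤ → ℤ → ℤ√
γnum D q n a b c d = (q * a + n * c + d * D) +√ (q * b + c + n * d)

IdealEq : ℤ → ℤ → ℤ → ℤ√ → Set
IdealEq D q n G = ∀ z → InO D z → (InIdeal D q n z → InPrincipal D G z)
                                   × (InPrincipal D G z → InIdeal D q n z)

dioph : ℤ → ℤ → ℤ → ℤ → ℤ → ℤ → ℤ → ℤ → ℤ
dioph D q n l a b c d =
  q * a * a - q * D * b * b + + 2 * (n * c + d * D) * a
  - + 2 * D * (c + n * d) * b + (c * c - d * d * D) * l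

{-# OPTIONS --safe #-}
-- Put ω = n + √D, α = (a + b√D)/δ and β = (c + d√D)/δ, so that γ = qα + ωβ lies in
-- I = (q, ω) and, since n² − D = lq, N(γ) = q·dio/δ² where dio is the left-hand side of
-- the equation without the ±δ² term.
--
-- If dio = ±δ², i.e. N(γ) = ±q, then q = ±γ·γ̄ and ω = ±γ·(ωγ̄/q), where ωγ̄/q = ωᾱ + lβ̄
-- is integral because ωω̄ = lq; hence I ⊆ (γ) ⊆ I.  Conversely, if I = (γ), write q = μγ
-- and ω = νγ.  Then N(μ)N(γ) = q², and the √D-coefficient of q·μ̄ν = N(μ)·ω shows
-- q ∣ δ²N(μ).  As q is an odd prime, q ∤ δ², so q divides both N(μ) and N(γ), whence
-- N(γ) = ±q.
module Submission where

open import Defs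
open import Data.Nat using (ℕ)
open import Data.Nat.Primality using (Prime)
open import Data.Integer using (ℤ; +_; _+_; _-_; _*_)
open import Data.Integer.Divisibility using (_∣_)
open import Data.Product using (_×_)
open import Data.Sum using (_⊎_)
open import Function.Bundles using (_⇔_)
open import Relation.Binary.PropositionalEquality using (_≡_; _≢_)
open import Relation.Nullary using (¬_)

open import Algebra.Bundles using (CommutativeSemigroup)
import Algebra.Properties.CommutativeSemigroup as CommutativeSemigroupProperties
open import Data.Bool using (true; false; T)
open import Data.List using (_∷_; [])
import Data.Nat as ℕ
import Data.Nat.Properties as ℕ
import Data.Nat.Divisibility as ℕ
open import Data.Nat.Coprimality using (Coprime; coprime-divisor)
open import Data.Nat.Primality using (prime⇒irreducible; prime⇒nonZero; euclidsLemma; irreducible[2]; ¬prime[1])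
open import Data.Integer as ℤ using (-[1+_]; -_; ∣_∣; _%ℕ_; _/ℕ_)
import Data.Integer.Properties as ℤ
open import Data.Integer.DivMod using (a≡a%ℕn+[a/ℕn]*n)
import Data.Integer.Divisibility.Signed as Signed
open import Data.Integer.Tactic.RingSolver using (solve)
open import Data.Product using (∃; _,_; proj₁; proj₂)
open import Data.Sum using (inj₁; inj₂; reduce)
open import Data.Unit using (tt)
open import Function.Bundles using (mk⇔)
open import Level using (0ℓ)
open import Relation.Binary.PropositionalEquality using (refl; sym; trans; cong; cong₂; subst; module ≡-Reasoning)
open import Relation.Binary.PropositionalEquality.Algebra using (isMagma)
open import Relation.Nullary using (contradiction)

open ≡-Reasoning

pattern ι k = k +√ + 0
pattern ω n = n +√ + 1

conj : ℤ√ → ℤ√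
conj (x +√ y) = x +√ - y

norm : ℤ → ℤ√ → ℤ
norm D (x +√ y) = x * x - D * (y * y)

infixl 6 _⊕_
infixr 7 _⋆_

_⊕_ : ℤ√ → ℤ√ → ℤ√
_⊕_ = add

_⋆_ : ℤ → ℤ√ → ℤ√
_⋆_ = scale

⋆-identityˡ : ∀ X → + 1 ⋆ X ≡ X
⋆-identityˡ (x +√ y) = cong₂ _+√_ (ℤ.*-identityˡ x) (ℤ.*-identityˡ y)

⋆-assoc : ∀ j k X → j ⋆ (k ⋆ X) ≡ (j * k) ⋆ X
⋆-assoc j k (x +√ y) = cong₂ _+√_ (sym (ℤ.*-assoc j k x)) (sym (ℤ.*-assoc j k y))

⋆-comm : ∀ j k X → j ⋆ (k ⋆ X) ≡ k ⋆ (j ⋆ X)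
⋆-comm j k X = begin
  j ⋆ (k ⋆ X)  ≡⟨ ⋆-assoc j k X ⟩
  (j * k) ⋆ X  ≡⟨ cong (_⋆ X) (ℤ.*-comm j k) ⟩
  (k * j) ⋆ X  ≡⟨ ⋆-assoc k j X ⟨
  k ⋆ (j ⋆ X)  ∎

⋆-distribˡ-⊕ : ∀ k X Y → k ⋆ (X ⊕ Y) ≡ k ⋆ X ⊕ k ⋆ Y
⋆-distribˡ-⊕ k (x +√ y) (u +√ v) = cong₂ _+√_ (ℤ.*-distribˡ-+ k x u) (ℤ.*-distribˡ-+ k y v)

⋆-ι : ∀ j k → j ⋆ ι k ≡ ι (j * k)
⋆-ι j k = cong (j * k +√_) (ℤ.*-zeroʳ j)

⋆-zeroˡ : ∀ X → + 0 ⋆ X ≡ ι (+ 0)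
⋆-zeroˡ (x +√ y) = refl

⊕-identityʳ : ∀ X → X ⊕ ι (+ 0) ≡ X
⊕-identityʳ (x +√ y) = cong₂ _+√_ (ℤ.+-identityʳ x) (ℤ.+-identityʳ y)

⊕-identityˡ : ∀ X → ι (+ 0) ⊕ X ≡ X
⊕-identityˡ (x +√ y) = cong₂ _+√_ (ℤ.+-identityˡ x) (ℤ.+-identityˡ y)

⋆-cancelˡ : ∀ k .{{_ : ℤ.NonZero k}} {X Y} → k ⋆ X ≡ k ⋆ Y → X ≡ Y
⋆-cancelˡ k {x +√ y} {u +√ v} eq =
  cong₂ _+√_ (ℤ.*-cancelˡ-≡ k x u (cong re eq)) (ℤ.*-cancelˡ-≡ k y v (cong im eq))

conj-⊕ : ∀ X Y → conj (X ⊕ Y) ≡ conj X ⊕ conj Y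
conj-⊕ (x +√ y) (u +√ v) = cong (x + u +√_) (ℤ.neg-distrib-+ y v)

conj-⋆ : ∀ k X → conj (k ⋆ X) ≡ k ⋆ conj X
conj-⋆ k (x +√ y) = cong (k * x +√_) (ℤ.neg-distribʳ-* k y)

δ-spec : ∀ D → (OneMod4 D × δ D ≡ + 2) ⊎ (¬ OneMod4 D × δ D ≡ + 1)
δ-spec D with D %ℕ 4 ℕ.≡ᵇ 1 in eq
... | true  = inj₁ (ℕ.≡ᵇ⇒≡ _ _ (subst T (sym eq) tt) , refl)
... | false = inj₂ ((λ r≡1 → subst T eq (ℕ.≡⇒≡ᵇ _ _ r≡1)) , refl)

δ-nonZero : ∀ D → ℤ.NonZero (δ D)
δ-nonZero D with δ-spec D
... | inj₁ (_ , δ≡2) rewrite δ≡2 = _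
... | inj₂ (_ , δ≡1) rewrite δ≡1 = _

∣i∣≡1⇒i≡±1 : ∀ {i} → ∣ i ∣ ≡ 1 → i ≡ + 1 ⊎ i ≡ - + 1
∣i∣≡1⇒i≡±1 {+ 1}                      _  = inj₁ refl
∣i∣≡1⇒i≡±1 { -[1+ 0 ]}                _  = inj₂ refl
∣i∣≡1⇒i≡±1 {+ 0}                      ()
∣i∣≡1⇒i≡±1 {+ (ℕ.suc (ℕ.suc _))}      ()
∣i∣≡1⇒i≡±1 { -[1+ ℕ.suc _ ]}          ()

prime∤⇒coprime : ∀ {p m} → Prime p → ¬ p ℕ.∣ m → Coprime p m
prime∤⇒coprime p-prime p∤m (d∣p , d∣m) with prime⇒irreducible p-prime d∣p
... | inj₁ d≡1 = d≡1
... | inj₂ refl = contradiction d∣m p∤m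

odd-prime∤4 : ∀ {p} → Prime p → p ≢ 2 → ¬ p ℕ.∣ 4
odd-prime∤4 p-prime p≢2 p∣4 with irreducible[2] (reduce (euclidsLemma 2 2 p-prime p∣4))
... | inj₁ refl = ¬prime[1] p-prime
... | inj₂ p≡2  = p≢2 p≡2

∣δ²∣∣4 : ∀ D → ∣ δ D * δ D ∣ ℕ.∣ 4
∣δ²∣∣4 D with δ-spec D
... | inj₁ (_ , δ≡2) rewrite δ≡2 = ℕ.∣-refl
... | inj₂ (_ , δ≡1) rewrite δ≡1 = ℕ.1∣ 4

coprime-δ² : ∀ D {q} → Prime q → q ≢ 2 → Coprime q ∣ δ D * δ D ∣
coprime-δ² D q-prime q≢2 =
  prime∤⇒coprime q-prime (λ q∣δ² → odd-prime∤4 q-prime q≢2 (ℕ.∣-trans q∣δ² (∣δ²∣∣4 D)))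

coprime-∣m*y⇒∣y : ∀ {q m a y} → Coprime ∣ q ∣ ∣ m ∣ → q * a ≡ m * y → q Signed.∣ y
coprime-∣m*y⇒∣y {q} {m} {a} {y} coprime qa≡my =
  Signed.∣ᵤ⇒∣ (coprime-divisor coprime (ℕ.divides ∣ a ∣ (begin
    ∣ m ∣ ℕ.* ∣ y ∣  ≡⟨ ℤ.abs-* m y ⟨
    ∣ m * y ∣        ≡⟨ cong ∣_∣ qa≡my ⟨
    ∣ q * a ∣        ≡⟨ ℤ.abs-* q a ⟩
    ∣ q ∣ ℕ.* ∣ a ∣  ≡⟨ ℕ.*-comm ∣ q ∣ ∣ a ∣ ⟩
    ∣ a ∣ ℕ.* ∣ q ∣  ∎)))

coprime-divisor⇒±1 : ∀ {q m x e w} → Coprime ∣ q ∣ ∣ m ∣ → x * e ≡ q → e * w ≡ m → e ≡ + 1 ⊎ e ≡ - + 1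
coprime-divisor⇒±1 {x = x} {e} {w} coprime xe≡q ew≡m = ∣i∣≡1⇒i≡±1 (coprime (∣e∣∣∣q∣ , ∣e∣∣∣m∣))
  where
  ∣e∣∣∣q∣ = ℕ.divides ∣ x ∣ (trans (cong ∣_∣ (sym xe≡q)) (ℤ.abs-* x e))
  ∣e∣∣∣m∣ = ℕ.divides ∣ w ∣ (trans (cong ∣_∣ (sym ew≡m)) (trans (ℤ.abs-* e w) (ℕ.*-comm ∣ e ∣ ∣ w ∣)))

±-of-unit : ∀ {x m e} → x ≡ m * e → e ≡ + 1 ⊎ e ≡ - + 1 → x + m ≡ + 0 ⊎ x - m ≡ + 0
±-of-unit {x} {m} x≡me (inj₁ refl) = inj₂ (begin
  x - m         ≡⟨ cong (λ t → t - m) x≡me ⟩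
  m * + 1 - m   ≡⟨ solve (m ∷ []) ⟩
  + 0           ∎)
±-of-unit {x} {m} x≡me (inj₂ refl) = inj₁ (begin
  x + m         ≡⟨ cong (λ t → t + m) x≡me ⟩
  m * - + 1 + m ≡⟨ solve (m ∷ []) ⟩
  + 0           ∎)

unit-of-± : ∀ {x m} → x + m ≡ + 0 ⊎ x - m ≡ + 0 → ∃ λ ε → ε * ε ≡ + 1 × x ≡ ε * m
unit-of-± {x} {m} (inj₁ x+m≡0) = - + 1 , refl , (begin
  x             ≡⟨ solve (x ∷ m ∷ []) ⟩
  x + m - m     ≡⟨ cong (λ t → t - m) x+m≡0 ⟩
  + 0 - m       ≡⟨ solve (m ∷ []) ⟩
  - + 1 * m     ∎)
unit-of-± {x} {m} (inj₂ x-m≡0) = + 1 , refl , (begin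
  x             ≡⟨ solve (x ∷ m ∷ []) ⟩
  x - m + m     ≡⟨ cong (λ t → t + m) x-m≡0 ⟩
  + 0 + m       ≡⟨ solve (m ∷ []) ⟩
  + 1 * m       ∎)

-- q ∣ y as q is prime to m; then e = y/q divides q (x·e = q) and m (e·w = m), so e = ±1.
±m-from-norms : ∀ {q m x y w dio} .{{_ : ℤ.NonZero q}} .{{_ : ℤ.NonZero m}} → Coprime ∣ q ∣ ∣ m ∣ →
  m * x * (m * y) ≡ m * m * (q * q) → q * w ≡ m * x → q * dio ≡ m * y →
  dio + m ≡ + 0 ⊎ dio - m ≡ + 0
±m-from-norms {q} {m} {x} {y} {w} {dio} coprime norms qw≡mx qdio≡my
  with coprime-∣m*y⇒∣y {q} {m} {dio} {y} coprime qdio≡my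
... | Signed.divides e y≡eq =
  ±-of-unit {dio} {m} {e} dio≡me (coprime-divisor⇒±1 {q} {m} {x} {e} {w} coprime xe≡q ew≡m)
  where
  dio≡me : dio ≡ m * e
  dio≡me = ℤ.*-cancelˡ-≡ q _ _ (begin
    q * dio       ≡⟨ qdio≡my ⟩
    m * y         ≡⟨ cong (m *_) y≡eq ⟩
    m * (e * q)   ≡⟨ solve (m ∷ e ∷ q ∷ []) ⟩
    q * (m * e)   ∎)
  xe≡q : x * e ≡ q
  xe≡q = ℤ.*-cancelʳ-≡ _ _ q (ℤ.*-cancelˡ-≡ m _ _ (ℤ.*-cancelˡ-≡ m _ _ (begin
    m * (m * (x * e * q))  ≡⟨ solve (m ∷ x ∷ e ∷ q ∷ []) ⟩
    m * x * (m * (e * q))  ≡⟨ cong (λ t → m * x * (m * t)) y≡eq ⟨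
    m * x * (m * y)        ≡⟨ norms ⟩
    m * m * (q * q)        ≡⟨ ℤ.*-assoc m m (q * q) ⟩
    m * (m * (q * q))      ∎)))
  instance
    x≢0 : ℤ.NonZero x
    x≢0 = ℤ.≢-nonZero {x} λ x≡0 → ℕ.≢-nonZero⁻¹ ∣ q ∣ (cong ∣_∣ (begin
      q      ≡⟨ xe≡q ⟨
      x * e  ≡⟨ cong (_* e) x≡0 ⟩
      + 0 * e ≡⟨ ℤ.*-zeroˡ e ⟩
      + 0    ∎))
  ew≡m : e * w ≡ m
  ew≡m = ℤ.*-cancelˡ-≡ x _ _ (begin
    x * (e * w)   ≡⟨ solve (x ∷ e ∷ w ∷ []) ⟩
    x * e * w     ≡⟨ cong (_* w) xe≡q ⟩
    q * w         ≡⟨ qw≡mx ⟩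
    m * x         ≡⟨ ℤ.*-comm m x ⟩
    x * m         ∎)

ε-cancel : ∀ ε q m → ε * ε ≡ + 1 → ε * (q * (ε * m)) ≡ m * q
ε-cancel ε q m ε²≡1 = begin
  ε * (q * (ε * m))  ≡⟨ solve (ε ∷ q ∷ m ∷ []) ⟩
  ε * ε * (m * q)    ≡⟨ cong (_* (m * q)) ε²≡1 ⟩
  + 1 * (m * q)      ≡⟨ ℤ.*-identityˡ (m * q) ⟩
  m * q              ∎

even : ∀ e t → e ≡ t * + 2 → + 2 ∣ e
even _ t eq = Signed.∣⇒∣ᵤ (Signed.divides t eq)

module QuadraticIntegers (D : ℤ) where

  infixl 7 _·_

  _·_ : ℤ√ → ℤ√ → ℤ√
  _·_ = mul D

  ·-comm : ∀ X Y → X · Y ≡ Y · X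
  ·-comm (a +√ b) (c +√ d) = cong₂ _+√_ (solve (D ∷ a ∷ b ∷ c ∷ d ∷ [])) (solve (a ∷ b ∷ c ∷ d ∷ []))

  ·-assoc : ∀ X Y Z → (X · Y) · Z ≡ X · (Y · Z)
  ·-assoc (a +√ b) (c +√ d) (e +√ f) = begin
    ((a * c + D * (b * d)) +√ (a * d + c * b)) · (e +√ f)
      ≡⟨ cong₂ _+√_ (solve (D ∷ a ∷ b ∷ c ∷ d ∷ e ∷ f ∷ [])) (solve (D ∷ a ∷ b ∷ c ∷ d ∷ e ∷ f ∷ [])) ⟩
    (a +√ b) · ((c * e + D * (d * f)) +√ (c * f + e * d))
      ∎

  ·-distribˡ-⊕ : ∀ X Y Z → X · (Y ⊕ Z) ≡ X · Y ⊕ X · Z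
  ·-distribˡ-⊕ (a +√ b) (c +√ d) (e +√ f) = begin
    (a +√ b) · ((c + e) +√ (d + f))
      ≡⟨ cong₂ _+√_ (solve (D ∷ a ∷ b ∷ c ∷ d ∷ e ∷ f ∷ [])) (solve (a ∷ b ∷ c ∷ d ∷ e ∷ f ∷ [])) ⟩
    ((a * c + D * (b * d)) +√ (a * d + c * b)) ⊕ ((a * e + D * (b * f)) +√ (a * f + e * b))
      ∎

  ·-⋆ : ∀ k X Y → X · (k ⋆ Y) ≡ k ⋆ (X · Y)
  ·-⋆ k (a +√ b) (c +√ d) = begin
    (a +√ b) · ((k * c) +√ (k * d))
      ≡⟨ cong₂ _+√_ (solve (D ∷ k ∷ a ∷ b ∷ c ∷ d ∷ [])) (solve (k ∷ a ∷ b ∷ c ∷ d ∷ [])) ⟩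
    k ⋆ ((a * c + D * (b * d)) +√ (a * d + c * b))
      ∎

  ·-ι : ∀ k X → X · ι k ≡ k ⋆ X
  ·-ι k (a +√ b) = cong₂ _+√_ (solve (D ∷ k ∷ a ∷ b ∷ [])) (solve (k ∷ a ∷ b ∷ []))

  conj-· : ∀ X Y → conj (X · Y) ≡ conj X · conj Y
  conj-· (a +√ b) (c +√ d) = begin
    (a * c + D * (b * d)) +√ - (a * d + c * b)
      ≡⟨ cong₂ _+√_ (solve (D ∷ a ∷ b ∷ c ∷ d ∷ [])) (solve (a ∷ b ∷ c ∷ d ∷ [])) ⟩
    (a +√ - b) · (c +√ - d)
      ∎

  conj-mul : ∀ X → conj X · X ≡ ι (norm D X)
  conj-mul (a +√ b) = begin
    (a +√ - b) · (a +√ b)        ≡⟨ cong₂ _+√_ (solve (D ∷ a ∷ b ∷ [])) (solve (a ∷ b ∷ [])) ⟩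
    ι (a * a - D * (b * b))      ∎

  ω-conj-mul : ∀ n → ω n · conj (ω n) ≡ ι (n * n - D)
  ω-conj-mul n = begin
    (n +√ + 1) · (n +√ - + 1)    ≡⟨ cong₂ _+√_ (solve (D ∷ n ∷ [])) (solve (n ∷ [])) ⟩
    ι (n * n - D)                ∎

  norm-mul : ∀ X Y → norm D (X · Y) ≡ norm D X * norm D Y
  norm-mul (a +√ b) (c +√ d) = begin
    (a * c + D * (b * d)) * (a * c + D * (b * d)) - D * ((a * d + c * b) * (a * d + c * b))
      ≡⟨ solve (D ∷ a ∷ b ∷ c ∷ d ∷ []) ⟩
    (a * a - D * (b * b)) * (c * c - D * (d * d))
      ∎

  norm-⋆-ι : ∀ m q → norm D (m ⋆ ι q) ≡ m * m * (q * q)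
  norm-⋆-ι m q = begin
    m * q * (m * q) - D * (m * + 0 * (m * + 0))  ≡⟨ solve (D ∷ m ∷ q ∷ []) ⟩
    m * m * (q * q)                              ∎

  ·-commutativeSemigroup : CommutativeSemigroup 0ℓ 0ℓ
  ·-commutativeSemigroup = record
    { isCommutativeSemigroup = record
      { isSemigroup = record { isMagma = isMagma _·_ ; assoc = ·-assoc }
      ; comm        = ·-comm
      }
    }

  open CommutativeSemigroupProperties ·-commutativeSemigroup using (interchange; x∙yz≈y∙xz)

  ⋆-· : ∀ k X Y → (k ⋆ X) · Y ≡ k ⋆ (X · Y)
  ⋆-· k X Y = begin
    (k ⋆ X) · Y  ≡⟨ ·-comm (k ⋆ X) Y ⟩
    Y · (k ⋆ X)  ≡⟨ ·-⋆ k Y X ⟩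
    k ⋆ (Y · X)  ≡⟨ cong (k ⋆_) (·-comm Y X) ⟩
    k ⋆ (X · Y)  ∎

  ·-distribʳ-⊕ : ∀ X Y Z → (X ⊕ Y) · Z ≡ X · Z ⊕ Y · Z
  ·-distribʳ-⊕ X Y Z = begin
    (X ⊕ Y) · Z    ≡⟨ ·-comm (X ⊕ Y) Z ⟩
    Z · (X ⊕ Y)    ≡⟨ ·-distribˡ-⊕ Z X Y ⟩
    Z · X ⊕ Z · Y  ≡⟨ cong₂ _⊕_ (·-comm Z X) (·-comm Z Y) ⟩
    X · Z ⊕ Y · Z  ∎

  -- Integrality

  OneMod4⇒≡1+4k : OneMod4 D → ∃ λ k → D ≡ + 1 + k * + 4
  OneMod4⇒≡1+4k r≡1 = D /ℕ 4 , trans (a≡a%ℕn+[a/ℕn]*n D 4) (cong (λ r → + r + D /ℕ 4 * + 4) r≡1)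

  InO-view : ∀ {x y} → OneMod4 D → InO D (x +√ y) → ∃ λ t → x ≡ y + t * + 2
  InO-view {x} {y} h X∈O with Signed.∣ᵤ⇒∣ (X∈O h)
  ... | Signed.divides t x-y≡t*2 = t , (begin
    x           ≡⟨ solve (x ∷ y ∷ []) ⟩
    y + (x - y) ≡⟨ cong (λ e → y + e) x-y≡t*2 ⟩
    y + t * + 2 ∎)

  InO-0 : InO D (ι (+ 0))
  InO-0 _ = even (+ 0 - + 0) (+ 0) refl

  InO-δ : InO D (ι (δ D))
  InO-δ h with δ-spec D
  ... | inj₁ (_ , δ≡2) rewrite δ≡2 = even (+ 2 - + 0) (+ 1) refl
  ... | inj₂ (¬h , _)              = contradiction h ¬h

  InO-⊕ : ∀ X Y → InO D X → InO D Y → InO D (X ⊕ Y)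
  InO-⊕ (x +√ y) (u +√ v) X∈O Y∈O h with InO-view {x} {y} h X∈O | InO-view {u} {v} h Y∈O
  ... | t , refl | s , refl =
    even ((y + t * + 2 + (v + s * + 2)) - (y + v)) (t + s) (solve (y ∷ v ∷ t ∷ s ∷ []))

  InO-⋆ : ∀ k X → InO D X → InO D (k ⋆ X)
  InO-⋆ k (x +√ y) X∈O h with InO-view {x} {y} h X∈O
  ... | t , refl = even (k * (y + t * + 2) - k * y) (k * t) (solve (k ∷ y ∷ t ∷ []))

  InO-conj : ∀ X → InO D X → InO D (conj X)
  InO-conj (x +√ y) X∈O h with InO-view {x} {y} h X∈O
  ... | t , refl = even (y + t * + 2 - - y) (y + t) (solve (y ∷ t ∷ []))

  InO-·ˡ : ∀ U X → InO D X → InO D (U · X)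
  InO-·ˡ (u +√ v) (x +√ y) X∈O h with InO-view {x} {y} h X∈O | OneMod4⇒≡1+4k h
  ... | t , refl | k , D≡1+4k rewrite D≡1+4k =
    even ((u * (y + t * + 2) + (+ 1 + k * + 4) * (v * y)) - (u * y + (y + t * + 2) * v))
         (u * t - t * v + + 2 * k * v * y) (solve (u ∷ v ∷ y ∷ t ∷ k ∷ []))

  InO-mul : ∀ M X → InO D M → InO D X → ∃ λ P → InO D P × M · X ≡ δ D ⋆ P
  InO-mul M X M∈O X∈O with δ-spec D
  ... | inj₂ (¬h , δ≡1) rewrite δ≡1 =
    M · X , (λ h → contradiction h ¬h) , sym (⋆-identityˡ (M · X))
  InO-mul (x +√ y) (u +√ v) M∈O X∈O | inj₁ (h , δ≡2)
    with InO-view {x} {y} h M∈O | InO-view {u} {v} h X∈O | OneMod4⇒≡1+4k h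
  ... | t , refl | s , refl | k , D≡1+4k rewrite δ≡2 | D≡1+4k =
    ((y * v + y * s + t * v + + 2 * t * s + + 2 * k * y * v) +√ (y * v + t * v + s * y)) ,
    (λ _ → even ((y * v + y * s + t * v + + 2 * t * s + + 2 * k * y * v) - (y * v + t * v + s * y))
                (t * s + k * y * v) (solve (y ∷ v ∷ t ∷ s ∷ k ∷ []))) ,
    product
    where
    product : mul (+ 1 + k * + 4) ((y + t * + 2) +√ y) ((v + s * + 2) +√ v)
            ≡ + 2 ⋆ ((y * v + y * s + t * v + + 2 * t * s + + 2 * k * y * v) +√ (y * v + t * v + s * y))
    product = cong₂ _+√_ (solve (y ∷ v ∷ t ∷ s ∷ k ∷ [])) (solve (y ∷ v ∷ t ∷ s ∷ k ∷ []))

  norm-InO : ∀ M → InO D M → ∃ λ N → norm D M ≡ δ D * δ D * N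
  norm-InO M M∈O with δ-spec D
  ... | inj₂ (_ , δ≡1) rewrite δ≡1 = norm D M , sym (ℤ.*-identityˡ (norm D M))
  norm-InO (x +√ y) M∈O | inj₁ (h , δ≡2) with InO-view {x} {y} h M∈O | OneMod4⇒≡1+4k h
  ... | t , refl | k , D≡1+4k rewrite δ≡2 | D≡1+4k =
    t * y + t * t - k * y * y , normal-form
    where
    normal-form : (y + t * + 2) * (y + t * + 2) - (+ 1 + k * + 4) * (y * y)
                ≡ + 2 * + 2 * (t * y + t * t - k * y * y)
    normal-form = solve (y ∷ t ∷ k ∷ [])

  -- The ideal (q, n + √D) and principal ideals

  InO-ideal-element : ∀ q n M L → InO D M → InO D L → InO D (q ⋆ M ⊕ ω n · L)
  InO-ideal-element q n M L M∈O L∈O = InO-⊕ (q ⋆ M) (ω n · L) (InO-⋆ q M M∈O) (InO-·ˡ (ω n) L L∈O)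

  principal⊆ideal : ∀ {q n G A C z} → G ≡ q ⋆ A ⊕ ω n · C → InO D A → InO D C →
    InPrincipal D G z → InIdeal D q n z
  principal⊆ideal {q} {n} {A = A} {C} {z} refl A∈O C∈O (M , M∈O , δz≡MG) =
    let (P , P∈O , MA≡δP) = InO-mul M A M∈O A∈O
        (Q , Q∈O , MC≡δQ) = InO-mul M C M∈O C∈O
    in P , Q , P∈O , Q∈O , ⋆-cancelˡ (δ D) {{δ-nonZero D}} (begin
      δ D ⋆ z                              ≡⟨ δz≡MG ⟩
      M · (q ⋆ A ⊕ ω n · C)                ≡⟨ ·-distribˡ-⊕ M (q ⋆ A) (ω n · C) ⟩
      M · (q ⋆ A) ⊕ M · (ω n · C)          ≡⟨ cong₂ _⊕_ (·-⋆ q M A) (x∙yz≈y∙xz M (ω n) C) ⟩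
      q ⋆ (M · A) ⊕ ω n · (M · C)          ≡⟨ cong₂ (λ U V → q ⋆ U ⊕ ω n · V) MA≡δP MC≡δQ ⟩
      q ⋆ (δ D ⋆ P) ⊕ ω n · (δ D ⋆ Q)      ≡⟨ cong₂ _⊕_ (⋆-comm q (δ D) P) (·-⋆ (δ D) (ω n) Q) ⟩
      δ D ⋆ (q ⋆ P) ⊕ δ D ⋆ (ω n · Q)      ≡⟨ ⋆-distribˡ-⊕ (δ D) (q ⋆ P) (ω n · Q) ⟨
      δ D ⋆ (q ⋆ P ⊕ ω n · Q)              ∎)

  ideal⊆principal : ∀ {q n G z} U₁ U₂ → InO D U₁ → InO D U₂ →
    U₁ · G ≡ (δ D * δ D) ⋆ ι q → U₂ · G ≡ (δ D * δ D) ⋆ ω n →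
    InIdeal D q n z → InPrincipal D G z
  ideal⊆principal {q} {n} {G} U₁ U₂ U₁∈O U₂∈O U₁G≡δ²q U₂G≡δ²ω (M , L , M∈O , L∈O , refl) =
    let (P , P∈O , MU₁≡δP) = InO-mul M U₁ M∈O U₁∈O
        (Q , Q∈O , LU₂≡δQ) = InO-mul L U₂ L∈O U₂∈O
    in P ⊕ Q , InO-⊕ P Q P∈O Q∈O , ⋆-cancelˡ (δ D) {{δ-nonZero D}} (begin
      δ D ⋆ (δ D ⋆ (q ⋆ M ⊕ ω n · L))   ≡⟨ ⋆-assoc (δ D) (δ D) (q ⋆ M ⊕ ω n · L) ⟩
      δ² ⋆ (q ⋆ M ⊕ ω n · L)            ≡⟨ ⋆-distribˡ-⊕ δ² (q ⋆ M) (ω n · L) ⟩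
      δ² ⋆ (q ⋆ M) ⊕ δ² ⋆ (ω n · L)     ≡⟨ cong₂ _⊕_ δ²qM≡MU₁G δ²ωL≡LU₂G ⟩
      M · (U₁ · G) ⊕ L · (U₂ · G)       ≡⟨ cong₂ _⊕_ (·-assoc M U₁ G) (·-assoc L U₂ G) ⟨
      (M · U₁) · G ⊕ (L · U₂) · G       ≡⟨ cong₂ (λ U V → U · G ⊕ V · G) MU₁≡δP LU₂≡δQ ⟩
      (δ D ⋆ P) · G ⊕ (δ D ⋆ Q) · G     ≡⟨ ·-distribʳ-⊕ (δ D ⋆ P) (δ D ⋆ Q) G ⟨
      (δ D ⋆ P ⊕ δ D ⋆ Q) · G           ≡⟨ cong (_· G) (⋆-distribˡ-⊕ (δ D) P Q) ⟨
      (δ D ⋆ (P ⊕ Q)) · G               ≡⟨ ⋆-· (δ D) (P ⊕ Q) G ⟩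
      δ D ⋆ ((P ⊕ Q) · G)               ∎)
    where
    δ² = δ D * δ D
    δ²qM≡MU₁G : δ² ⋆ (q ⋆ M) ≡ M · (U₁ · G)
    δ²qM≡MU₁G = begin
      δ² ⋆ (q ⋆ M)      ≡⟨ cong (δ² ⋆_) (·-ι q M) ⟨
      δ² ⋆ (M · ι q)    ≡⟨ ·-⋆ δ² M (ι q) ⟨
      M · (δ² ⋆ ι q)    ≡⟨ cong (M ·_) U₁G≡δ²q ⟨
      M · (U₁ · G)      ∎
    δ²ωL≡LU₂G : δ² ⋆ (ω n · L) ≡ L · (U₂ · G)
    δ²ωL≡LU₂G = begin
      δ² ⋆ (ω n · L)    ≡⟨ cong (δ² ⋆_) (·-comm (ω n) L) ⟩
      δ² ⋆ (L · ω n)    ≡⟨ ·-⋆ δ² L (ω n) ⟨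
      L · (δ² ⋆ ω n)    ≡⟨ cong (L ·_) U₂G≡δ²ω ⟨
      L · (U₂ · G)      ∎

  q-cofactor : ∀ {q m G} ε → ε * ε ≡ + 1 → norm D G ≡ q * (ε * m) → (ε ⋆ conj G) · G ≡ m ⋆ ι q
  q-cofactor {q} {m} {G} ε ε²≡1 NG≡qεm = begin
    (ε ⋆ conj G) · G        ≡⟨ ⋆-· ε (conj G) G ⟩
    ε ⋆ (conj G · G)        ≡⟨ cong (ε ⋆_) (conj-mul G) ⟩
    ε ⋆ ι (norm D G)        ≡⟨ cong (λ N → ε ⋆ ι N) NG≡qεm ⟩
    ε ⋆ ι (q * (ε * m))     ≡⟨ ⋆-ι ε (q * (ε * m)) ⟩
    ι (ε * (q * (ε * m)))   ≡⟨ cong (λ x → ι x) (ε-cancel ε q m ε²≡1) ⟩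
    ι (m * q)               ≡⟨ ⋆-ι m q ⟨
    m ⋆ ι q                 ∎

  ω-cofactor : ∀ {q n m G Y} ε .{{_ : ℤ.NonZero q}} → ε * ε ≡ + 1 → norm D G ≡ q * (ε * m) →
    q ⋆ (Y · G) ≡ norm D G ⋆ ω n → (ε ⋆ Y) · G ≡ m ⋆ ω n
  ω-cofactor {q} {n} {m} {G} {Y} ε ε²≡1 NG≡qεm qYG≡Nω = ⋆-cancelˡ q (begin
    q ⋆ ((ε ⋆ Y) · G)           ≡⟨ cong (q ⋆_) (⋆-· ε Y G) ⟩
    q ⋆ (ε ⋆ (Y · G))           ≡⟨ ⋆-comm q ε (Y · G) ⟩
    ε ⋆ (q ⋆ (Y · G))           ≡⟨ cong (ε ⋆_) qYG≡Nω ⟩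
    ε ⋆ (norm D G ⋆ ω n)        ≡⟨ cong (λ N → ε ⋆ (N ⋆ ω n)) NG≡qεm ⟩
    ε ⋆ ((q * (ε * m)) ⋆ ω n)   ≡⟨ ⋆-assoc ε (q * (ε * m)) (ω n) ⟩
    (ε * (q * (ε * m))) ⋆ ω n   ≡⟨ cong (_⋆ ω n) (trans (ε-cancel ε q m ε²≡1) (ℤ.*-comm m q)) ⟩
    (q * m) ⋆ ω n               ≡⟨ ⋆-assoc q m (ω n) ⟨
    q ⋆ (m ⋆ ω n)               ∎)

  ±δ²⇒ideal⊆principal : ∀ {q n G Y z} ε .{{_ : ℤ.NonZero q}} → ε * ε ≡ + 1 → InO D G → InO D Y →
    q ⋆ (Y · G) ≡ norm D G ⋆ ω n → norm D G ≡ q * (ε * (δ D * δ D)) →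
    InIdeal D q n z → InPrincipal D G z
  ±δ²⇒ideal⊆principal {q} {n} {G} {Y} {z} ε ε²≡1 G∈O Y∈O qYG≡Nω NG≡qεδ² =
    ideal⊆principal {q} {n} {G} {z} (ε ⋆ conj G) (ε ⋆ Y)
      (InO-⋆ ε (conj G) (InO-conj G G∈O)) (InO-⋆ ε Y Y∈O)
      (q-cofactor {q} {δ D * δ D} {G} ε ε²≡1 NG≡qεδ²)
      (ω-cofactor {q} {n} {δ D * δ D} {G} {Y} ε ε²≡1 NG≡qεδ² qYG≡Nω)

  ideal-element-q : ∀ q n k → q ⋆ ι k ⊕ ω n · ι (+ 0) ≡ k ⋆ ι q
  ideal-element-q q n k = begin
    q ⋆ ι k ⊕ ω n · ι (+ 0)  ≡⟨ cong (q ⋆ ι k ⊕_) (·-ι (+ 0) (ω n)) ⟩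
    q ⋆ ι k ⊕ + 0 ⋆ ω n      ≡⟨ cong (q ⋆ ι k ⊕_) (⋆-zeroˡ (ω n)) ⟩
    q ⋆ ι k ⊕ ι (+ 0)        ≡⟨ ⊕-identityʳ (q ⋆ ι k) ⟩
    q ⋆ ι k                  ≡⟨ ⋆-ι q k ⟩
    ι (q * k)                ≡⟨ cong (λ x → ι x) (ℤ.*-comm q k) ⟩
    ι (k * q)                ≡⟨ ⋆-ι k q ⟨
    k ⋆ ι q                  ∎

  ideal-element-ω : ∀ q n k → q ⋆ ι (+ 0) ⊕ ω n · ι k ≡ k ⋆ ω n
  ideal-element-ω q n k = begin
    q ⋆ ι (+ 0) ⊕ ω n · ι k  ≡⟨ cong₂ _⊕_ (⋆-ι q (+ 0)) (·-ι k (ω n)) ⟩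
    ι (q * + 0) ⊕ k ⋆ ω n    ≡⟨ cong (λ x → ι x ⊕ k ⋆ ω n) (ℤ.*-zeroʳ q) ⟩
    ι (+ 0) ⊕ k ⋆ ω n        ≡⟨ ⊕-identityˡ (k ⋆ ω n) ⟩
    k ⋆ ω n                  ∎

  -- Compare √D-coefficients in q·(conj M₁ · M₂) = N(M₁)·(n + √D).
  q-divides-norm : ∀ {q n G M₁ M₂} m .{{_ : ℤ.NonZero m}} → M₁ · G ≡ m ⋆ ι q → M₂ · G ≡ m ⋆ ω n →
    q * im (conj M₁ · M₂) ≡ norm D M₁
  q-divides-norm {q} {n} {G} {M₁} {M₂} m M₁G≡mq M₂G≡mω = begin
    q * im W         ≡⟨ cong im qW≡Nω ⟩
    norm D M₁ * + 1  ≡⟨ ℤ.*-identityʳ (norm D M₁) ⟩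
    norm D M₁        ∎
    where
    W = conj M₁ · M₂
    qW≡Nω : q ⋆ W ≡ norm D M₁ ⋆ ω n
    qW≡Nω = ⋆-cancelˡ m (begin
      m ⋆ (q ⋆ W)                  ≡⟨ cong (m ⋆_) (·-ι q W) ⟨
      m ⋆ (W · ι q)                ≡⟨ ·-⋆ m W (ι q) ⟨
      W · (m ⋆ ι q)                ≡⟨ cong (W ·_) M₁G≡mq ⟨
      W · (M₁ · G)                 ≡⟨ interchange (conj M₁) M₂ M₁ G ⟩
      (conj M₁ · M₁) · (M₂ · G)    ≡⟨ cong₂ _·_ (conj-mul M₁) M₂G≡mω ⟩
      ι (norm D M₁) · (m ⋆ ω n)    ≡⟨ ·-⋆ m (ι (norm D M₁)) (ω n) ⟩
      m ⋆ (ι (norm D M₁) · ω n)    ≡⟨ cong (m ⋆_) (·-comm (ι (norm D M₁)) (ω n)) ⟩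
      m ⋆ (ω n · ι (norm D M₁))    ≡⟨ cong (m ⋆_) (·-ι (norm D M₁) (ω n)) ⟩
      m ⋆ (norm D M₁ ⋆ ω n)        ∎)

  principal⇒cofactors : ∀ {q n G} → IdealEq D q n G →
    ∃ λ M₁ → ∃ λ M₂ → InO D M₁ × M₁ · G ≡ (δ D * δ D) ⋆ ι q × M₂ · G ≡ (δ D * δ D) ⋆ ω n
  principal⇒cofactors {q} {n} {G} I
    with proj₁ (I (q ⋆ ι (δ D) ⊕ ω n · ι (+ 0)) (InO-ideal-element q n _ _ InO-δ InO-0))
               (ι (δ D) , ι (+ 0) , InO-δ , InO-0 , refl)
       | proj₁ (I (q ⋆ ι (+ 0) ⊕ ω n · ι (δ D)) (InO-ideal-element q n _ _ InO-0 InO-δ))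
               (ι (+ 0) , ι (δ D) , InO-0 , InO-δ , refl)
  ... | M₁ , M₁∈O , δz₁≡M₁G | M₂ , _ , δz₂≡M₂G = M₁ , M₂ , M₁∈O , M₁G≡δ²q , M₂G≡δ²ω
    where
    M₁G≡δ²q : M₁ · G ≡ (δ D * δ D) ⋆ ι q
    M₁G≡δ²q = begin
      M₁ · G                              ≡⟨ δz₁≡M₁G ⟨
      δ D ⋆ (q ⋆ ι (δ D) ⊕ ω n · ι (+ 0)) ≡⟨ cong (δ D ⋆_) (ideal-element-q q n (δ D)) ⟩
      δ D ⋆ (δ D ⋆ ι q)                   ≡⟨ ⋆-assoc (δ D) (δ D) (ι q) ⟩
      (δ D * δ D) ⋆ ι q                   ∎
    M₂G≡δ²ω : M₂ · G ≡ (δ D * δ D) ⋆ ω n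
    M₂G≡δ²ω = begin
      M₂ · G                              ≡⟨ δz₂≡M₂G ⟨
      δ D ⋆ (q ⋆ ι (+ 0) ⊕ ω n · ι (δ D)) ≡⟨ cong (δ D ⋆_) (ideal-element-ω q n (δ D)) ⟩
      δ D ⋆ (δ D ⋆ ω n)                   ≡⟨ ⋆-assoc (δ D) (δ D) (ω n) ⟩
      (δ D * δ D) ⋆ ω n                   ∎

  cofactor-norms : ∀ {q m G M x y} → M · G ≡ m ⋆ ι q → norm D M ≡ m * x → norm D G ≡ m * y →
    m * x * (m * y) ≡ m * m * (q * q)
  cofactor-norms {q} {m} {G} {M} {x} {y} MG≡mq NM≡mx NG≡my = begin
    m * x * (m * y)       ≡⟨ cong₂ _*_ NM≡mx NG≡my ⟨
    norm D M * norm D G   ≡⟨ norm-mul M G ⟨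
    norm D (M · G)        ≡⟨ cong (norm D) MG≡mq ⟩
    norm D (m ⋆ ι q)      ≡⟨ norm-⋆-ι m q ⟩
    m * m * (q * q)       ∎

  principal⇒±δ² : ∀ {q : ℕ} {n G dio} → Prime q → q ≢ 2 → InO D G → IdealEq D (+ q) n G →
    + q * dio ≡ norm D G → dio + δ D * δ D ≡ + 0 ⊎ dio - δ D * δ D ≡ + 0
  principal⇒±δ² {q} {n} {G} {dio} q-prime q≢2 G∈O I qdio≡NG =
    let (M₁ , M₂ , M₁∈O , M₁G≡δ²q , M₂G≡δ²ω) = principal⇒cofactors {+ q} {n} {G} I
        (x , NM₁≡δ²x) = norm-InO M₁ M₁∈O
        (y , NG≡δ²y)  = norm-InO G G∈O
    in ±m-from-norms {+ q} {δ²} {x} {y} {im (conj M₁ · M₂)} {dio} {{prime⇒nonZero q-prime}} {{δ²≢0}}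
         (coprime-δ² D q-prime q≢2)
         (cofactor-norms {+ q} {δ²} {G} {M₁} {x} {y} M₁G≡δ²q NM₁≡δ²x NG≡δ²y)
         (trans (q-divides-norm {+ q} {n} {G} {M₁} {M₂} δ² {{δ²≢0}} M₁G≡δ²q M₂G≡δ²ω) NM₁≡δ²x)
         (trans qdio≡NG NG≡δ²y)
    where
    δ² = δ D * δ D
    δ²≢0 = ℤ.i*j≢0 (δ D) (δ D) {{δ-nonZero D}} {{δ-nonZero D}}

  γ-decomposition : ∀ q n a b c d → γnum D q n a b c d ≡ q ⋆ (a +√ b) ⊕ ω n · (c +√ d)
  γ-decomposition q n a b c d = begin
    (q * a + n * c + d * D) +√ (q * b + c + n * d)
      ≡⟨ cong₂ _+√_ (solve (D ∷ q ∷ n ∷ a ∷ b ∷ c ∷ d ∷ [])) (solve (q ∷ n ∷ a ∷ b ∷ c ∷ d ∷ [])) ⟩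
    ((q * a) +√ (q * b)) ⊕ ((n * c + D * (+ 1 * d)) +√ (n * d + c * + 1))
      ∎

  norm-γ : ∀ q n l a b c d → n * n - D ≡ l * q → norm D (γnum D q n a b c d) ≡ q * dioph D q n l a b c d
  norm-γ q n l a b c d n²-D≡lq = begin
    (q * a + n * c + d * D) * (q * a + n * c + d * D) - D * ((q * b + c + n * d) * (q * b + c + n * d))
      ≡⟨ solve (D ∷ q ∷ n ∷ l ∷ a ∷ b ∷ c ∷ d ∷ []) ⟩
    q * (q * a * a - q * D * b * b + + 2 * (n * c + d * D) * a - + 2 * D * (c + n * d) * b
         + (c * c - d * d * D) * l)
      + (c * c - d * d * D) * (n * n - D - l * q)
      ≡⟨ cong (λ t → q * dio + (c * c - d * d * D) * t) n²-D-lq≡0 ⟩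
    q * dio + (c * c - d * d * D) * + 0
      ≡⟨ cong (λ t → q * dio + t) (ℤ.*-zeroʳ (c * c - d * d * D)) ⟩
    q * dio + + 0
      ≡⟨ ℤ.+-identityʳ (q * dio) ⟩
    q * dio
      ∎
    where
    dio = dioph D q n l a b c d
    n²-D-lq≡0 : n * n - D - l * q ≡ + 0
    n²-D-lq≡0 = trans (cong (_- l * q) n²-D≡lq) (ℤ.+-inverseʳ (l * q))

  -- So ω·conj(qA + ωC) is divisible by q, because ω·conj ω = n² − D = lq.
  q⋆cofactor : ∀ q n l A C → n * n - D ≡ l * q →
    q ⋆ (ω n · conj A ⊕ l ⋆ conj C) ≡ ω n · conj (q ⋆ A ⊕ ω n · C)
  q⋆cofactor q n l A C n²-D≡lq = sym (begin
    ω n · conj (q ⋆ A ⊕ ω n · C)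
      ≡⟨ cong (ω n ·_) (trans (conj-⊕ (q ⋆ A) (ω n · C)) (cong₂ _⊕_ (conj-⋆ q A) (conj-· (ω n) C))) ⟩
    ω n · (q ⋆ conj A ⊕ conj (ω n) · conj C)
      ≡⟨ ·-distribˡ-⊕ (ω n) (q ⋆ conj A) (conj (ω n) · conj C) ⟩
    ω n · (q ⋆ conj A) ⊕ ω n · (conj (ω n) · conj C)
      ≡⟨ cong₂ _⊕_ (·-⋆ q (ω n) (conj A)) (sym (·-assoc (ω n) (conj (ω n)) (conj C))) ⟩
    q ⋆ (ω n · conj A) ⊕ (ω n · conj (ω n)) · conj C
      ≡⟨ cong (λ U → q ⋆ (ω n · conj A) ⊕ U · conj C) (trans (ω-conj-mul n) (cong (λ x → ι x) n²-D≡lq)) ⟩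
    q ⋆ (ω n · conj A) ⊕ ι (l * q) · conj C
      ≡⟨ cong (q ⋆ (ω n · conj A) ⊕_) lq·C̄≡q⋆lC̄ ⟩
    q ⋆ (ω n · conj A) ⊕ q ⋆ (l ⋆ conj C)
      ≡⟨ ⋆-distribˡ-⊕ q (ω n · conj A) (l ⋆ conj C) ⟨
    q ⋆ (ω n · conj A ⊕ l ⋆ conj C)
      ∎)
    where
    lq·C̄≡q⋆lC̄ : ι (l * q) · conj C ≡ q ⋆ (l ⋆ conj C)
    lq·C̄≡q⋆lC̄ = begin
      ι (l * q) · conj C   ≡⟨ ·-comm (ι (l * q)) (conj C) ⟩
      conj C · ι (l * q)   ≡⟨ ·-ι (l * q) (conj C) ⟩
      (l * q) ⋆ conj C     ≡⟨ cong (_⋆ conj C) (ℤ.*-comm l q) ⟩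
      (q * l) ⋆ conj C     ≡⟨ ⋆-assoc q l (conj C) ⟨
      q ⋆ (l ⋆ conj C)     ∎

  γ-cofactor : ∀ {G} q n l A C → G ≡ q ⋆ A ⊕ ω n · C → n * n - D ≡ l * q →
    q ⋆ ((ω n · conj A ⊕ l ⋆ conj C) · G) ≡ norm D G ⋆ ω n
  γ-cofactor {G} q n l A C G≡qA+ωC n²-D≡lq = begin
    q ⋆ (Y · G)                           ≡⟨ ⋆-· q Y G ⟨
    (q ⋆ Y) · G                           ≡⟨ cong (_· G) (q⋆cofactor q n l A C n²-D≡lq) ⟩
    (ω n · conj (q ⋆ A ⊕ ω n · C)) · G    ≡⟨ cong (λ H → (ω n · conj H) · G) G≡qA+ωC ⟨
    (ω n · conj G) · G                    ≡⟨ ·-assoc (ω n) (conj G) G ⟩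
    ω n · (conj G · G)                    ≡⟨ cong (ω n ·_) (conj-mul G) ⟩
    ω n · ι (norm D G)                    ≡⟨ ·-ι (norm D G) (ω n) ⟩
    norm D G ⋆ ω n                        ∎
    where Y = ω n · conj A ⊕ l ⋆ conj C

module PrincipalGenerator (D : ℤ) (q : ℕ) (q-prime : Prime q) (q≢2 : q ≢ 2) (n l a b c d : ℤ)
  (n²-D≡lq : n * n - D ≡ l * + q) (parity : OneMod4 D → (+ 2 ∣ (a - b)) × (+ 2 ∣ (c - d))) where

  open QuadraticIntegers D

  A C G Y : ℤ√
  A = a +√ b
  C = c +√ d
  G = γnum D (+ q) n a b c d
  Y = ω n · conj A ⊕ l ⋆ conj C

  dio δ² : ℤ
  dio = dioph D (+ q) n l a b c d
  δ² = δ D * δ D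

  A∈O : InO D A
  A∈O h = proj₁ (parity h)

  C∈O : InO D C
  C∈O h = proj₂ (parity h)

  G≡qA+ωC : G ≡ + q ⋆ A ⊕ ω n · C
  G≡qA+ωC = γ-decomposition (+ q) n a b c d

  G∈O : InO D G
  G∈O = subst (InO D) (sym G≡qA+ωC) (InO-ideal-element (+ q) n A C A∈O C∈O)

  Y∈O : InO D Y
  Y∈O = InO-⊕ (ω n · conj A) (l ⋆ conj C) (InO-·ˡ (ω n) (conj A) (InO-conj A A∈O))
                                           (InO-⋆ l (conj C) (InO-conj C C∈O))

  NG≡qdio : norm D G ≡ + q * dio
  NG≡qdio = norm-γ (+ q) n l a b c d n²-D≡lq

  IdealEq⇒±δ² : IdealEq D (+ q) n G → dio + δ² ≡ + 0 ⊎ dio - δ² ≡ + 0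
  IdealEq⇒±δ² I = principal⇒±δ² {q} {n} {G} {dio} q-prime q≢2 G∈O I (sym NG≡qdio)

  ±δ²⇒IdealEq : dio + δ² ≡ + 0 ⊎ dio - δ² ≡ + 0 → IdealEq D (+ q) n G
  ±δ²⇒IdealEq dio≡±δ² z _ with unit-of-± {dio} {δ²} dio≡±δ²
  ... | ε , ε²≡1 , dio≡εδ² =
    ±δ²⇒ideal⊆principal {+ q} {n} {G} {Y} {z} ε {{prime⇒nonZero q-prime}} ε²≡1 G∈O Y∈O
      (γ-cofactor (+ q) n l A C G≡qA+ωC n²-D≡lq) (trans NG≡qdio (cong (λ t → + q * t) dio≡εδ²)) ,
    principal⊆ideal {+ q} {n} {G} {A} {C} {z} G≡qA+ωC A∈O C∈O

lemma3p1 : (D : ℤ) → SquareFree D → D ≢ + 1 →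
    (q : ℕ) → Prime q → q ≢ 2 → ¬ (+ q ∣ D) →
    (n l : ℤ) → n * n - D ≡ l * + q →
    (a b c d : ℤ) → (OneMod4 D → (+ 2 ∣ (a - b)) × (+ 2 ∣ (c - d))) →
    IdealEq D (+ q) n (γnum D (+ q) n a b c d)
      ⇔ ((dioph D (+ q) n l a b c d + δ D * δ D ≡ + 0)
          ⊎ (dioph D (+ q) n l a b c d - δ D * δ D ≡ + 0))
lemma3p1 D _ _ q q-prime q≢2 _ n l n²-D≡lq a b c d parity = mk⇔ IdealEq⇒±δ² ±δ²⇒IdealEq
  where open PrincipalGenerator D q q-prime q≢2 n l a b c d n²-D≡lq parity
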